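{- Let $\mathcal B$ be a building set on a finite set $V$. If $(B_1,B_1',P)$ and $(B_2,B_2',P)$ are two maximal exchange frames with $\{B_1,B_1'\}\neq\{B_2,B_2'\}$ and with the same $\mathbf g$-vector dependence, i.e. $\mathbf n(B_1,B_1',P)=\mathbf n(B_2,B_2',P)$, then $P$ is elementary.
   Context: A building set on $V$ is a set $\mathcal B$ of non-empty subsets of $V$ containing all singletons such that $B\cap B'\ne\varnothing$ implies $B\cup B'\in\mathcal B$; $\kappa(\mathcal B)$ is its set of inclusion-maximal blocks; for $U\subseteq V$, $\kappa(U)$ is the set of inclusion-maximal blocks contained in $U$. A block $P$ is elementary if $|P|>1$ and $P=B'\cup B''$ with $B',B''\in\mathcal B\setminus\{P\}$ implies $B'\cap B''=\varnothing$. A $\mathcal B$-nested set is $\mathcal N\subseteq\mathcal B$ whose members are pairwise nested or disjoint, with no union of $k\ge2$ pairwise disjoint members in $\mathcal B$, and $\kappa(\mathcal B)\subseteq\mathcal N$. For inclusion-maximal nested sets with $\mathcal N\setminus\{B\}=\mathcal N'\setminus\{B'\}$, $B\ne B'$, the parent $P$ is the unique minimal element of $\{C\in\mathcal N:B\subsetneq C\}$, and $(B,B',P)$ is an exchange frame; it is maximal if $B$ and $B'$ are inclusion-maximal among blocks strictly contained in $P$. With $(\mathbf f_C)_{C\in\mathcal B}$ the standard basis of $\mathbb R^{\mathcal B}$, the $\mathbf g$-vector dependence of a frame is encoded by $\mathbf n(B,B',P)=\mathbf f_B+\mathbf f_{B'}+\sum_{K\in\kappa(P\setminus(B\cup B'))}\mathbf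 f_K-\mathbf f_P-\sum_{K\in\kappa(B\cap B')}\mathbf f_K$. -}

module Defs where

open import Level using (0ℓ) renaming (suc to lsuc)
open import Data.Nat using (ℕ; _≤_; _<_)
open import Data.Integer using (ℤ; 0ℤ; 1ℤ; _+_; _-_)
open import Data.Bool using () renaming (_≟_ to _≟ᵇ_)
open import Data.Vec.Properties using (≡-dec)
open import Data.List using (List; length)
open import Data.List.Relation.Unary.All using (All)
open import Data.List.Relation.Unary.AllPairs using (AllPairs)
open import Data.Fin using (Fin)
open import Data.Fin.Subset
  using (Subset; ⁅_⁆; _⊆_; _⊂_; _∩_; _∪_; _─_; ⋃; ⊤; Nonempty; Empty; ∣_∣)
open import Data.Fin.Subset.Properties using (_⊆?_; anySubset?)
open import Data.Product using (_×_; _,_; Σ; ∃; ∃-syntax)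
open import Data.Sum using (_⊎_)
open import Data.Empty using (⊥-elim)
open import Relation.Nullary using (¬_; Dec; yes; no; ¬?)
open import Relation.Nullary.Decidable using (_×-dec_)
open import Relation.Unary using (Pred; Decidable)
open import Relation.Binary.PropositionalEquality using (_≡_; _≢_)
open import Function.Bundles using (_⇔_)

-- The ground set V is Fin n; subsets of V are 'Subset n'.
-- A family of subsets of V (building set, nested set) is a predicate.
Family : ℕ → Set₁
Family n = Pred (Subset n) 0ℓ

_≟ˢ_ : ∀ {n} (p q : Subset n) → Dec (p ≡ q)
_≟ˢ_ = ≡-dec _≟ᵇ_

module _ {n : ℕ} (𝓑 : Family n) where

  record IsBuildingSet : Set where
    field
      nonempty   : ∀ B → 𝓑 B → Nonempty B
      singletons : ∀ (i : Fin n) → 𝓑 ⁅ i ⁆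
      unionClosed : ∀ B B' → 𝓑 B → 𝓑 B' → Nonempty (B ∩ B') → 𝓑 (B ∪ B')

  -- C ∈ κ(U): C is an inclusion-maximal block contained in U
  IsMaxIn : Subset n → Subset n → Set
  IsMaxIn U C = 𝓑 C × C ⊆ U × (∀ D → 𝓑 D → C ⊆ D → D ⊆ U → D ≡ C)

  IsMaxBlock : Subset n → Set
  IsMaxBlock C = IsMaxIn ⊤ C

  IsElementary : Subset n → Set
  IsElementary P =
    𝓑 P × 1 < ∣ P ∣ ×
    (∀ B' B'' → 𝓑 B' → 𝓑 B'' → B' ≢ P → B'' ≢ P → P ≡ B' ∪ B'' → Empty (B' ∩ B''))

  record IsNested (𝓝 : Family n) : Set where
    field
      blocks   : ∀ N → 𝓝 N → 𝓑 N
      laminar  : ∀ N N' → 𝓝 N → 𝓝 N' → N ⊆ N' ⊎ N' ⊆ N ⊎ Empty (N ∩ N')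
      noUnion  : ∀ (Ns : List (Subset n)) → 2 ≤ length Ns → All 𝓝 Ns →
                 AllPairs (λ X Y → Empty (X ∩ Y)) Ns → ¬ 𝓑 (⋃ Ns)
      maxBlocks : ∀ C → IsMaxBlock C → 𝓝 C

  IsMaximalNested : Family n → Set₁
  IsMaximalNested 𝓝 =
    IsNested 𝓝 × (∀ 𝓝' → IsNested 𝓝' → (∀ C → 𝓝 C → 𝓝' C) → ∀ C → 𝓝' C → 𝓝 C)

  IsMinAbove : Family n → Subset n → Subset n → Set
  IsMinAbove 𝓝 B Q = 𝓝 Q × B ⊂ Q × (∀ C → 𝓝 C → B ⊂ C → C ⊆ Q → C ≡ Q)

  IsParent : Family n → Subset n → Subset n → Set
  IsParent 𝓝 B P = IsMinAbove 𝓝 B P × (∀ Q → IsMinAbove 𝓝 B Q → Q ≡ P)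

  IsExchangeFrame : Subset n → Subset n → Subset n → Set₁
  IsExchangeFrame B B' P =
    Σ (Family n) λ 𝓝 → Σ (Family n) λ 𝓝' →
      IsMaximalNested 𝓝 × IsMaximalNested 𝓝' × 𝓝 B × 𝓝' B' × B ≢ B' ×
      (∀ C → (𝓝 C × C ≢ B) ⇔ (𝓝' C × C ≢ B')) ×
      IsParent 𝓝 B P

  IsMaxBelow : Subset n → Subset n → Set
  IsMaxBelow P B = 𝓑 B × B ⊂ P × (∀ D → 𝓑 D → D ⊂ P → B ⊆ D → D ≡ B)

  IsMaxExchangeFrame : Subset n → Subset n → Subset n → Set₁
  IsMaxExchangeFrame B B' P =
    IsExchangeFrame B B' P × IsMaxBelow P B × IsMaxBelow P B'

  module _ (𝓑? : Decidable 𝓑) where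

    maxIn? : ∀ U C → Dec (IsMaxIn U C)
    maxIn? U C with 𝓑? C ×-dec (C ⊆? U)
                  | anySubset? (λ D → 𝓑? D ×-dec (C ⊆? D) ×-dec (D ⊆? U) ×-dec ¬? (D ≟ˢ C))
    ... | no ¬bc | _ = no λ { (b , c , _) → ¬bc (b , c) }
    ... | yes _  | yes (D , b , c , d , ne) = no λ { (_ , _ , f) → ne (f D b c d) }
    ... | yes (b , c) | no ¬∃ = yes (b , c , f)
      where
      f : ∀ D → 𝓑 D → C ⊆ D → D ⊆ U → D ≡ C
      f D bD cD dU with D ≟ˢ C
      ... | yes e = e
      ... | no ne = ⊥-elim (¬∃ (D , bD , cD , dU , ne))

    ind : ∀ {A : Set} → Dec A → ℤ
    ind (yes _) = 1ℤ
    ind (no _)  = 0ℤ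

    -- coefficient of f_C in
    -- n(B,B',P) = f_B + f_B' + Σ_{K∈κ(P∖(B∪B'))} f_K − f_P − Σ_{K∈κ(B∩B')} f_K
    nvec : Subset n → Subset n → Subset n → Subset n → ℤ
    nvec B B' P C =
      ind (C ≟ˢ B) + ind (C ≟ˢ B') + ind (maxIn? (P ─ (B ∪ B')) C)
      - ind (C ≟ˢ P) - ind (maxIn? (B ∩ B') C)

{-# OPTIONS --safe #-}
module Submission where

-- Suppose P = X ∪ Y with X, Y proper blocks sharing a point z. For a block B maximal below P,
-- a side W ∈ {X, Y} meeting B gives the block B ∪ W ⊆ P, so by maximality either W ⊆ B or
-- B ∪ W = P; as X ∪ Y ⊄ B, this puts P ∖ B inside one side. If two maximal blocks B, B' below
-- P were disjoint, that side would contain B' and hence equal it, so z ∈ B'; symmetrically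
-- z ∈ B. Hence any two maximal blocks below P meet, B ∪ B' = P, and κ(P ∖ (B ∪ B')) = ∅.
-- Then among non-empty sets n(B₁, B₁', P) takes the value 1 only at B₁ and B₁', while
-- n(B₂, B₂', P) takes it at B₂ and B₂', forcing {B₂, B₂'} = {B₁, B₁'}.

open import Defs
open import Data.Nat using (ℕ; _≤_; _<_)
open import Data.Nat.Properties using (≤-<-trans)
open import Data.Integer using (0ℤ; 1ℤ)
open import Data.Fin using (Fin)
open import Data.Fin.Subset
  using (Subset; _∈_; _∉_; _⊆_; _⊂_; _∩_; _∪_; _─_; Nonempty; Empty; ∣_∣; outside)
open import Data.Fin.Subset.Properties
open import Data.Product using (_×_; _,_; proj₁; proj₂)
open import Data.Sum using (_⊎_; inj₁; inj₂; [_,_]′; swap)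
open import Data.Empty using (⊥-elim)
open import Data.Vec.Base using (_∷_; here; there)
open import Function.Base using (_∘_)
open import Relation.Nullary using (¬_; Dec; yes; no; contradiction)
open import Relation.Unary using (Decidable)
open import Relation.Binary.PropositionalEquality using (_≡_; _≢_; refl; sym; trans; subst)

x∈p─q⇒x∉q : ∀ {n} {x : Fin n} (p q : Subset n) → x ∈ p ─ q → x ∉ q
x∈p─q⇒x∉q (_ ∷ p) (outside ∷ q) here      ()
x∈p─q⇒x∉q (_ ∷ p) (_       ∷ q) (there a) (there b) = x∈p─q⇒x∉q p q a b

p─q⊆r⇒p⊆q∪r : ∀ {n} {p q r : Subset n} → p ─ q ⊆ r → p ⊆ q ∪ r
p─q⊆r⇒p⊆q∪r {q = q} p─q⊆r {x} x∈p with x ∈? q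
... | yes x∈q = x∈p∪q⁺ (inj₁ x∈q)
... | no  x∉q = x∈p∪q⁺ (inj₂ (p─q⊆r (x∈p∧x∉q⇒x∈p─q x∈p x∉q)))

p⊆q∪r⇒p─q⊆r : ∀ {n} {p q r : Subset n} → p ⊆ q ∪ r → p ─ q ⊆ r
p⊆q∪r⇒p─q⊆r {p = p} {q} {r} p⊆q∪r x∈p─q with x∈p∪q⁻ q r (p⊆q∪r (p─q⊆p p q x∈p─q))
... | inj₁ x∈q = contradiction x∈q (x∈p─q⇒x∉q p q x∈p─q)
... | inj₂ x∈r = x∈r

nonempty∧⊆q⇒⊈p─q : ∀ {n} {c p q : Subset n} → Nonempty c → c ⊆ q → ¬ c ⊆ p ─ q
nonempty∧⊆q⇒⊈p─q {p = p} {q} (x , x∈c) c⊆q c⊆p─q = x∈p─q⇒x∉q p q (c⊆p─q x∈c) (c⊆q x∈c)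

⊂⇒⊉ : ∀ {n} {p q : Subset n} → p ⊂ q → ¬ q ⊆ p
⊂⇒⊉ (_ , _ , x∈q , x∉p) q⊆p = x∉p (q⊆p x∈q)

⊂⇒≢ : ∀ {n} {p q : Subset n} → p ⊂ q → p ≢ q
⊂⇒≢ p⊂q refl = ⊂⇒⊉ p⊂q (λ x∈p → x∈p)

⊆∧≢⇒⊂ : ∀ {n} {p q : Subset n} → p ⊆ q → p ≢ q → p ⊂ q
⊆∧≢⇒⊂ {p = p} {q} p⊆q p≢q with nonempty? (q ─ p)
... | yes (x , x∈q─p) = p⊆q , x , p─q⊆p q p x∈q─p , x∈p─q⇒x∉q q p x∈q─p
... | no  q─p-empty   = contradiction (⊆-antisym p⊆q q⊆p) p≢q
  where
  q⊆p : q ⊆ p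
  q⊆p {x} x∈q with x ∈? p
  ... | yes x∈p = x∈p
  ... | no  x∉p = ⊥-elim (q─p-empty (x , x∈p∧x∉q⇒x∈p─q x∈q x∉p))

nonempty∧⊂⇒1<∣q∣ : ∀ {n} {p q : Subset n} → Nonempty p → p ⊂ q → 1 < ∣ q ∣
nonempty∧⊂⇒1<∣q∣ {p = p} (x , x∈p) p⊂q = ≤-<-trans 1≤∣p∣ (p⊂q⇒∣p∣<∣q∣ p⊂q)
  where
  1≤∣p∣ : 1 ≤ ∣ p ∣
  1≤∣p∣ = subst (_≤ ∣ p ∣) (∣⁅x⁆∣≡1 x)
                (p⊆q⇒∣p∣≤∣q∣ (λ y∈⁅x⁆ → subst (_∈ p) (sym (x∈⁅y⁆⇒x≡y x y∈⁅x⁆)) x∈p))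

module MaxBelow {n : ℕ} {𝓑 : Family n} (bs : IsBuildingSet 𝓑) {P : Subset n} where
  open IsBuildingSet bs

  maxBelow-nonempty : ∀ {B} → IsMaxBelow 𝓑 P B → Nonempty B
  maxBelow-nonempty (𝓑B , _) = nonempty _ 𝓑B

  absorbs-or-covers : ∀ {B W} → IsMaxBelow 𝓑 P B → 𝓑 W → W ⊆ P → Nonempty (B ∩ W) →
                      W ⊆ B ⊎ P ─ B ⊆ W
  absorbs-or-covers {B} {W} (𝓑B , B⊂P , maxB) 𝓑W W⊆P B∩W≠∅ with (B ∪ W) ≟ˢ P
  ... | yes B∪W≡P = inj₂ (p⊆q∪r⇒p─q⊆r (subst (P ⊆_) (sym B∪W≡P) (λ x∈P → x∈P)))
  ... | no  B∪W≢P = inj₁ (subst (W ⊆_) B∪W≡B (q⊆p∪q B W))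
    where
    B∪W⊆P : B ∪ W ⊆ P
    B∪W⊆P x∈B∪W = [ proj₁ B⊂P , W⊆P ]′ (x∈p∪q⁻ B W x∈B∪W)
    B∪W≡B : B ∪ W ≡ B
    B∪W≡B = maxB (B ∪ W) (unionClosed B W 𝓑B 𝓑W B∩W≠∅) (⊆∧≢⇒⊂ B∪W⊆P B∪W≢P) (p⊆p∪q W)

  covers-disjoint⇒≡ : ∀ {B B' W} → IsMaxBelow 𝓑 P B' → 𝓑 W → W ⊂ P → P ─ B ⊆ W →
                      Empty (B ∩ B') → W ≡ B'
  covers-disjoint⇒≡ {B} {B'} (_ , B'⊂P , maxB') 𝓑W W⊂P P─B⊆W B∩B'=∅ =
    maxB' _ 𝓑W W⊂P λ x∈B' →
      P─B⊆W (x∈p∧x∉q⇒x∈p─q (proj₁ B'⊂P x∈B') (λ x∈B → B∩B'=∅ (_ , x∈p∩q⁺ (x∈B , x∈B'))))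

  maxBelow-⊈ : ∀ {B B'} → IsMaxBelow 𝓑 P B → IsMaxBelow 𝓑 P B' → B ≢ B' → ¬ B ⊆ B'
  maxBelow-⊈ (_ , _ , maxB) (𝓑B' , B'⊂P , _) B≢B' B⊆B' = B≢B' (sym (maxB _ 𝓑B' B'⊂P B⊆B'))

  meeting-maxBelow-cover : ∀ {B B'} → IsMaxBelow 𝓑 P B → IsMaxBelow 𝓑 P B' → B ≢ B' →
                           Nonempty (B ∩ B') → P ⊆ B ∪ B'
  meeting-maxBelow-cover mB mB'@(𝓑B' , B'⊂P , _) B≢B' B∩B'≠∅
    with absorbs-or-covers mB 𝓑B' (proj₁ B'⊂P) B∩B'≠∅
  ... | inj₂ P─B⊆B' = p─q⊆r⇒p⊆q∪r P─B⊆B'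
  ... | inj₁ B'⊆B   = ⊥-elim (maxBelow-⊈ mB' mB (B≢B' ∘ sym) B'⊆B)

  complement⊆one-side : ∀ {B U V z} → IsMaxBelow 𝓑 P B → 𝓑 U → 𝓑 V → U ⊆ P → V ⊆ P →
                        P ⊆ U ∪ V → z ∈ U → z ∈ V → Nonempty (B ∩ U) → P ─ B ⊆ U ⊎ P ─ B ⊆ V
  complement⊆one-side {B} {U} {V} {z} mB@(_ , B⊂P , _) 𝓑U 𝓑V U⊆P V⊆P P⊆U∪V z∈U z∈V B∩U≠∅
    with absorbs-or-covers mB 𝓑U U⊆P B∩U≠∅
  ... | inj₂ P─B⊆U = inj₁ P─B⊆U
  ... | inj₁ U⊆B with absorbs-or-covers mB 𝓑V V⊆P (z , x∈p∩q⁺ (U⊆B z∈U , z∈V))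
  ...   | inj₂ P─B⊆V = inj₂ P─B⊆V
  ...   | inj₁ V⊆B = ⊥-elim (⊂⇒⊉ B⊂P λ x∈P → [ U⊆B , V⊆B ]′ (x∈p∪q⁻ U V (P⊆U∪V x∈P)))

  module Splitting {X Y : Subset n} (𝓑X : 𝓑 X) (𝓑Y : 𝓑 Y) (X≢P : X ≢ P) (Y≢P : Y ≢ P)
                   (P≡X∪Y : P ≡ X ∪ Y) {z : Fin n} (z∈X∩Y : z ∈ X ∩ Y) where

    z∈X : z ∈ X
    z∈X = proj₁ (x∈p∩q⁻ X Y z∈X∩Y)

    z∈Y : z ∈ Y
    z∈Y = proj₂ (x∈p∩q⁻ X Y z∈X∩Y)

    P⊆X∪Y : P ⊆ X ∪ Y
    P⊆X∪Y = subst (P ⊆_) P≡X∪Y (λ x∈P → x∈P)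

    X⊂P : X ⊂ P
    X⊂P = ⊆∧≢⇒⊂ (subst (X ⊆_) (sym P≡X∪Y) (p⊆p∪q Y)) X≢P

    Y⊂P : Y ⊂ P
    Y⊂P = ⊆∧≢⇒⊂ (subst (Y ⊆_) (sym P≡X∪Y) (q⊆p∪q X Y)) Y≢P

    complement⊆side : ∀ {B} → IsMaxBelow 𝓑 P B → P ─ B ⊆ X ⊎ P ─ B ⊆ Y
    complement⊆side {B} mB@(_ , B⊂P , _) with maxBelow-nonempty mB
    ... | b , b∈B with x∈p∪q⁻ X Y (P⊆X∪Y (proj₁ B⊂P b∈B))
    ...   | inj₁ b∈X = complement⊆one-side mB 𝓑X 𝓑Y (proj₁ X⊂P) (proj₁ Y⊂P) P⊆X∪Y
                         z∈X z∈Y (b , x∈p∩q⁺ (b∈B , b∈X))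
    ...   | inj₂ b∈Y = swap (complement⊆one-side mB 𝓑Y 𝓑X (proj₁ Y⊂P) (proj₁ X⊂P)
                         (subst (P ⊆_) (∪-comm X Y) P⊆X∪Y) z∈Y z∈X (b , x∈p∩q⁺ (b∈B , b∈Y)))

    z∈disjoint-maxBelow : ∀ {B B'} → IsMaxBelow 𝓑 P B → IsMaxBelow 𝓑 P B' → Empty (B ∩ B') → z ∈ B'
    z∈disjoint-maxBelow mB mB' B∩B'=∅ with complement⊆side mB
    ... | inj₁ P─B⊆X = subst (z ∈_) (covers-disjoint⇒≡ mB' 𝓑X X⊂P P─B⊆X B∩B'=∅) z∈X
    ... | inj₂ P─B⊆Y = subst (z ∈_) (covers-disjoint⇒≡ mB' 𝓑Y Y⊂P P─B⊆Y B∩B'=∅) z∈Y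

    maxBelow-meet : ∀ {B B'} → IsMaxBelow 𝓑 P B → IsMaxBelow 𝓑 P B' → Nonempty (B ∩ B')
    maxBelow-meet {B} {B'} mB mB' with nonempty? (B ∩ B')
    ... | yes B∩B'≠∅ = B∩B'≠∅
    ... | no  B∩B'=∅ = contradiction (_ , x∈p∩q⁺ (z∈B , z∈B')) B∩B'=∅
      where
      z∈B' : z ∈ B'
      z∈B' = z∈disjoint-maxBelow mB mB' B∩B'=∅
      z∈B : z ∈ B
      z∈B = z∈disjoint-maxBelow mB' mB (subst Empty (∩-comm B B') B∩B'=∅)

module GVectorDependence {n : ℕ} (𝓑 : Family n) (𝓑? : Decidable 𝓑) where

  ind-yes : ∀ {A : Set} → A → (a? : Dec A) → ind 𝓑 𝓑? a? ≡ 1ℤ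
  ind-yes a (yes _) = refl
  ind-yes a (no ¬a) = contradiction a ¬a

  ind-no : ∀ {A : Set} → ¬ A → (a? : Dec A) → ind 𝓑 𝓑? a? ≡ 0ℤ
  ind-no ¬a (yes a) = contradiction a ¬a
  ind-no ¬a (no _)  = refl

  nvec-first≡1 : ∀ {B B' P} → B ≢ B' → B ≢ P → ¬ IsMaxIn 𝓑 (P ─ (B ∪ B')) B →
                 ¬ IsMaxIn 𝓑 (B ∩ B') B → nvec 𝓑 𝓑? B B' P B ≡ 1ℤ
  nvec-first≡1 {B} {B'} {P} B≢B' B≢P B∉κ₁ B∉κ₂
    rewrite ind-yes refl (B ≟ˢ B) | ind-no B≢B' (B ≟ˢ B')
          | ind-no B∉κ₁ (maxIn? 𝓑 𝓑? (P ─ (B ∪ B')) B) | ind-no B≢P (B ≟ˢ P)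
          | ind-no B∉κ₂ (maxIn? 𝓑 𝓑? (B ∩ B') B) = refl

  nvec-second≡1 : ∀ {B B' P} → B' ≢ B → B' ≢ P → ¬ IsMaxIn 𝓑 (P ─ (B ∪ B')) B' →
                  ¬ IsMaxIn 𝓑 (B ∩ B') B' → nvec 𝓑 𝓑? B B' P B' ≡ 1ℤ
  nvec-second≡1 {B} {B'} {P} B'≢B B'≢P B'∉κ₁ B'∉κ₂
    rewrite ind-no B'≢B (B' ≟ˢ B) | ind-yes refl (B' ≟ˢ B')
          | ind-no B'∉κ₁ (maxIn? 𝓑 𝓑? (P ─ (B ∪ B')) B') | ind-no B'≢P (B' ≟ˢ P)
          | ind-no B'∉κ₂ (maxIn? 𝓑 𝓑? (B ∩ B') B') = refl

  -- The two subtracted terms can only lower the value below 1.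
  nvec≢1 : ∀ {B B' P C} → C ≢ B → C ≢ B' → ¬ IsMaxIn 𝓑 (P ─ (B ∪ B')) C →
           nvec 𝓑 𝓑? B B' P C ≢ 1ℤ
  nvec≢1 {B} {B'} {P} {C} C≢B C≢B' C∉κ
    rewrite ind-no C≢B (C ≟ˢ B) | ind-no C≢B' (C ≟ˢ B')
          | ind-no C∉κ (maxIn? 𝓑 𝓑? (P ─ (B ∪ B')) C)
    with C ≟ˢ P | maxIn? 𝓑 𝓑? (B ∩ B') C
  ... | yes _ | yes _ = λ ()
  ... | yes _ | no  _ = λ ()
  ... | no  _ | yes _ = λ ()
  ... | no  _ | no  _ = λ ()

  module _ (bs : IsBuildingSet 𝓑) {P : Subset n} where
    open MaxBelow bs

    nvec≡1-at-maxBelow : ∀ {B B'} → IsMaxBelow 𝓑 P B → IsMaxBelow 𝓑 P B' → B ≢ B' →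
                         nvec 𝓑 𝓑? B B' P B ≡ 1ℤ × nvec 𝓑 𝓑? B B' P B' ≡ 1ℤ
    nvec≡1-at-maxBelow {B} {B'} mB mB' B≢B' =
        nvec-first≡1 B≢B' (⊂⇒≢ (proj₁ (proj₂ mB)))
          (λ (_ , B⊆P─B∪B' , _) →
             nonempty∧⊆q⇒⊈p─q (maxBelow-nonempty mB) (p⊆p∪q B') B⊆P─B∪B')
          (λ (_ , B⊆B∩B' , _) → maxBelow-⊈ mB mB' B≢B' (p∩q⊆q B B' ∘ B⊆B∩B'))
      , nvec-second≡1 (B≢B' ∘ sym) (⊂⇒≢ (proj₁ (proj₂ mB')))
          (λ (_ , B'⊆P─B∪B' , _) →
             nonempty∧⊆q⇒⊈p─q (maxBelow-nonempty mB') (q⊆p∪q B B') B'⊆P─B∪B')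
          (λ (_ , B'⊆B∩B' , _) → maxBelow-⊈ mB' mB (B≢B' ∘ sym) (p∩q⊆p B B' ∘ B'⊆B∩B'))

    nvec≡1⇒frame-block : ∀ {B B' C} → P ⊆ B ∪ B' → Nonempty C → nvec 𝓑 𝓑? B B' P C ≡ 1ℤ →
                         C ≡ B ⊎ C ≡ B'
    nvec≡1⇒frame-block {B} {B'} {C} P⊆B∪B' C≠∅ nC≡1 = by-cases (C ≟ˢ B) (C ≟ˢ B')
      where
      C∉κ : ¬ IsMaxIn 𝓑 (P ─ (B ∪ B')) C
      C∉κ (_ , C⊆P─B∪B' , _) =
        nonempty∧⊆q⇒⊈p─q C≠∅ (λ x∈C → P⊆B∪B' (p─q⊆p P (B ∪ B') (C⊆P─B∪B' x∈C))) C⊆P─B∪B'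
      by-cases : Dec (C ≡ B) → Dec (C ≡ B') → C ≡ B ⊎ C ≡ B'
      by-cases (yes C≡B) _          = inj₁ C≡B
      by-cases (no _)    (yes C≡B') = inj₂ C≡B'
      by-cases (no C≢B)  (no C≢B')  = contradiction nC≡1 (nvec≢1 C≢B C≢B' C∉κ)

module _ {n : ℕ} {𝓑 : Family n} {B B' P : Subset n} where

  exchangeFrame-distinct : IsExchangeFrame 𝓑 B B' P → B ≢ B'
  exchangeFrame-distinct (_ , _ , _ , _ , _ , _ , B≢B' , _) = B≢B'

  exchangeFrame-parent∈𝓑 : IsExchangeFrame 𝓑 B B' P → 𝓑 P
  exchangeFrame-parent∈𝓑 (_ , _ , (𝓝-nested , _) , _ , _ , _ , _ , _ , (𝓝P , _) , _) =
    IsNested.blocks 𝓝-nested P 𝓝P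

distinct-pair-within : ∀ {A : Set} {a a' b b' : A} → b ≢ b' → b ≡ a ⊎ b ≡ a' → b' ≡ a ⊎ b' ≡ a' →
                       (a ≡ b × a' ≡ b') ⊎ (a ≡ b' × a' ≡ b)
distinct-pair-within b≢b' (inj₁ b≡a)  (inj₁ b'≡a)  = contradiction (trans b≡a (sym b'≡a)) b≢b'
distinct-pair-within b≢b' (inj₂ b≡a') (inj₂ b'≡a') = contradiction (trans b≡a' (sym b'≡a')) b≢b'
distinct-pair-within b≢b' (inj₁ b≡a)  (inj₂ b'≡a') = inj₁ (sym b≡a , sym b'≡a')
distinct-pair-within b≢b' (inj₂ b≡a') (inj₁ b'≡a)  = inj₂ (sym b'≡a , sym b≡a')

proposition3p22 :
    ∀ {n : ℕ} (𝓑 : Family n) (𝓑? : Decidable 𝓑) → IsBuildingSet 𝓑 →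
    ∀ (B₁ B₁' B₂ B₂' P : Subset n) →
    IsMaxExchangeFrame 𝓑 B₁ B₁' P →
    IsMaxExchangeFrame 𝓑 B₂ B₂' P →
    ¬ ((B₁ ≡ B₂ × B₁' ≡ B₂') ⊎ (B₁ ≡ B₂' × B₁' ≡ B₂)) →
    (∀ C → nvec 𝓑 𝓑? B₁ B₁' P C ≡ nvec 𝓑 𝓑? B₂ B₂' P C) →
    IsElementary 𝓑 P
proposition3p22 𝓑 𝓑? bs B₁ B₁' B₂ B₂' P (frame₁ , mB₁ , mB₁') (frame₂ , mB₂ , mB₂') different same-n =
  exchangeFrame-parent∈𝓑 frame₁ ,
  nonempty∧⊂⇒1<∣q∣ (maxBelow-nonempty mB₁) (proj₁ (proj₂ mB₁)) ,
  splitting-disjoint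
  where
  open MaxBelow bs
  open GVectorDependence 𝓑 𝓑?
  B₂≢B₂' : B₂ ≢ B₂'
  B₂≢B₂' = exchangeFrame-distinct frame₂

  splitting-disjoint : ∀ X Y → 𝓑 X → 𝓑 Y → X ≢ P → Y ≢ P → P ≡ X ∪ Y → Empty (X ∩ Y)
  splitting-disjoint X Y 𝓑X 𝓑Y X≢P Y≢P P≡X∪Y (z , z∈X∩Y) =
    different (distinct-pair-within B₂≢B₂' (frame₁-block mB₂ (proj₁ n₂≡1)) (frame₁-block mB₂' (proj₂ n₂≡1)))
    where
    open Splitting 𝓑X 𝓑Y X≢P Y≢P P≡X∪Y z∈X∩Y
    P⊆B₁∪B₁' : P ⊆ B₁ ∪ B₁'
    P⊆B₁∪B₁' = meeting-maxBelow-cover mB₁ mB₁' (exchangeFrame-distinct frame₁) (maxBelow-meet mB₁ mB₁')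
    frame₁-block : ∀ {C} → IsMaxBelow 𝓑 P C → nvec 𝓑 𝓑? B₂ B₂' P C ≡ 1ℤ → C ≡ B₁ ⊎ C ≡ B₁'
    frame₁-block {C} mC n₂C≡1 =
      nvec≡1⇒frame-block bs P⊆B₁∪B₁' (maxBelow-nonempty mC) (trans (same-n C) n₂C≡1)
    n₂≡1 : nvec 𝓑 𝓑? B₂ B₂' P B₂ ≡ 1ℤ × nvec 𝓑 𝓑? B₂ B₂' P B₂' ≡ 1ℤ
    n₂≡1 = nvec≡1-at-maxBelow bs mB₂ mB₂' B₂≢B₂'
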